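{- Let $A$ be an alphabet and $\theta\subseteq A\times A\setminus\{(a,a)\mid a\in A\}$ a symmetric relation, and let $\mathbb{M}(A,\theta)$ be the associated trace monoid. Let $C$ be a conjugacy class of $\mathbb{M}(A,\theta)$, let $f\in C$, $g\in\mathbb{M}(A,\theta)$ and $p\in\mathbb{N}$ be such that $f=g^p$. Then for each $f'\in C$ there exists $g'\in\mathbb{M}(A,\theta)$ such that $f'=g'^p$. Furthermore, $g$ and $g'$ are conjugate.
   Context: The trace monoid (free partially commutative monoid) $\mathbb{M}(A,\theta)$ is the quotient of the free monoid $A^*$ by the congruence generated by $ab=ba$ for $(a,b)\in\theta$; its elements are called traces. Two traces $t,t'$ are conjugate if there exists a trace $u$ with $tu=ut'$; this is an equivalence relation on $\mathbb{M}(A,\theta)$, whose classes are the conjugacy classes. -}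

module Defs where

open import Level using (Level; _⊔_) renaming (suc to lsuc)
open import Data.Nat using (ℕ; zero; suc)
open import Data.List using (List; []; _∷_; _++_)
open import Data.Product using (Σ; _×_)
open import Relation.Nullary using (¬_)

record Independence {a r : Level} (A : Set a) (θ : A → A → Set r) : Set (a ⊔ r) where
  field
    sym   : ∀ {x y} → θ x y → θ y x
    irrefl : ∀ {x} → ¬ θ x x

-- Traces (elements of 𝕄(A,θ)) are words up to this relation.
data TraceEq {a r : Level} {A : Set a} (θ : A → A → Set r) : List A → List A → Set (a ⊔ r) where
  swap  : (u v : List A) {x y : A} → θ x y →
          TraceEq θ (u ++ x ∷ y ∷ v) (u ++ y ∷ x ∷ v)
  refl  : ∀ {w} → TraceEq θ w w
  sym   : ∀ {w w'} → TraceEq θ w w' → TraceEq θ w' w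
  trans : ∀ {w w' w''} → TraceEq θ w w' → TraceEq θ w' w'' → TraceEq θ w w''

syntax TraceEq θ w w' = w ≈[ θ ] w'

_^_ : ∀ {a} {A : Set a} → List A → ℕ → List A
g ^ zero  = []
g ^ suc p = g ++ (g ^ p)

Conjugate : ∀ {a r} {A : Set a} (θ : A → A → Set r) → List A → List A → Set (a ⊔ r)
Conjugate {A = A} θ t t' = Σ (List A) (λ u → (t ++ u) ≈[ θ ] (u ++ t'))

{-# OPTIONS --safe #-}
-- Conjugacy is generated by rotating a single minimal letter: if f u ≈ u f'
-- with u = c u₁, then c is minimal in f u, so either f ≈ c f₁ and
-- f₁ c u₁ ≈ u₁ f', or every letter of f is independent of c and f u₁ ≈ u₁ f'.
-- Such a rotation preserves being the p-th power of a conjugate of g: if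
-- c f₁ ≈ g^p then c is minimal in g^p, hence in g (otherwise all of g^p would
-- be independent of c), so g ≈ c g₁ and cancelling c gives f₁ c ≈ (g₁ c)^p.
-- Both case distinctions rest on the fact that the first occurrence of a
-- minimal letter stays first under swaps of adjacent independent letters.
module Submission where

open import Defs
open import Level using (Level; _⊔_)
open import Data.Nat using (ℕ; zero; suc)
open import Data.List using (List; []; _∷_; _++_; [_])
open import Data.List.Properties using (++-assoc; ++-identityʳ)
open import Data.List.Relation.Unary.All using (All; []; _∷_)
open import Data.List.Relation.Unary.All.Properties using (++⁺)
open import Data.Product using (Σ; _×_; _,_)
open import Data.Sum using (_⊎_; inj₁; inj₂)
open import Data.Empty using (⊥-elim)
open import Relation.Nullary using (¬_)
open import Relation.Binary.Bundles using (Setoid)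
open import Relation.Binary.Definitions using (_Respects_)
open import Relation.Binary.PropositionalEquality as ≡ using (_≡_)
import Relation.Binary.Reasoning.Setoid as SetoidReasoning

^-rotate : ∀ {a} {A : Set a} (x y : List A) q → (x ++ (y ++ x) ^ q) ++ y ≡ (x ++ y) ^ suc q
^-rotate x y zero    = ≡.trans (≡.cong (_++ y) (++-identityʳ x)) (≡.sym (++-identityʳ (x ++ y)))
^-rotate x y (suc q) = begin
  (x ++ (y ++ x) ++ r) ++ y   ≡⟨ ++-assoc x ((y ++ x) ++ r) y ⟩
  x ++ ((y ++ x) ++ r) ++ y   ≡⟨ ≡.cong (x ++_) (++-assoc (y ++ x) r y) ⟩
  x ++ (y ++ x) ++ r ++ y     ≡⟨ ≡.cong (x ++_) (++-assoc y x (r ++ y)) ⟩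
  x ++ y ++ x ++ r ++ y       ≡⟨ ++-assoc x y (x ++ r ++ y) ⟨
  (x ++ y) ++ x ++ r ++ y     ≡⟨ ≡.cong ((x ++ y) ++_) (++-assoc x r y) ⟨
  (x ++ y) ++ (x ++ r) ++ y   ≡⟨ ≡.cong ((x ++ y) ++_) (^-rotate x y q) ⟩
  (x ++ y) ^ suc (suc q)      ∎
  where
    open ≡.≡-Reasoning
    r = (y ++ x) ^ q

all-^ : ∀ {a p} {A : Set a} {P : A → Set p} {g : List A} → All P g → ∀ q → All P (g ^ q)
all-^ all-g zero    = []
all-^ all-g (suc q) = ++⁺ all-g (all-^ all-g q)

module _ {a r} {A : Set a} {θ : A → A → Set r} where

  infix 4 _≈_
  _≈_ : List A → List A → Set (a ⊔ r)
  _≈_ = TraceEq θ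

  ≡⇒≈ : ∀ {w w'} → w ≡ w' → w ≈ w'
  ≡⇒≈ ≡.refl = refl

  ≈-setoid : Setoid a (a ⊔ r)
  ≈-setoid = record
    { _≈_           = _≈_
    ; isEquivalence = record { refl = refl ; sym = sym ; trans = trans }
    }

  ++-congˡ : ∀ u {w w'} → w ≈ w' → u ++ w ≈ u ++ w'
  ++-congˡ u (swap u' v {x} {y} t) =
    trans (≡⇒≈ (≡.sym (++-assoc u u' (x ∷ y ∷ v))))
          (trans (swap (u ++ u') v t) (≡⇒≈ (++-assoc u u' (y ∷ x ∷ v))))
  ++-congˡ u refl         = refl
  ++-congˡ u (sym e)      = sym (++-congˡ u e)
  ++-congˡ u (trans e e') = trans (++-congˡ u e) (++-congˡ u e')

  ++-congʳ : ∀ v {w w'} → w ≈ w' → w ++ v ≈ w' ++ v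
  ++-congʳ v (swap u' v' {x} {y} t) =
    trans (≡⇒≈ (++-assoc u' (x ∷ y ∷ v') v))
          (trans (swap u' (v' ++ v) t) (≡⇒≈ (≡.sym (++-assoc u' (y ∷ x ∷ v') v))))
  ++-congʳ v refl         = refl
  ++-congʳ v (sym e)      = sym (++-congʳ v e)
  ++-congʳ v (trans e e') = trans (++-congʳ v e) (++-congʳ v e')

  ^-cong : ∀ {g g'} → g ≈ g' → ∀ p → g ^ p ≈ g' ^ p
  ^-cong e zero             = refl
  ^-cong {g} {g'} e (suc p) = trans (++-congʳ (g ^ p) e) (++-congˡ g' (^-cong e p))

  conjugate-refl : ∀ g → Conjugate θ g g
  conjugate-refl g = [] , ≡⇒≈ (++-identityʳ g)

  conjugate-trans : ∀ {g h k} → Conjugate θ g h → Conjugate θ h k → Conjugate θ g k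
  conjugate-trans {g} {h} {k} (u , gu≈uh) (v , hv≈vk) = u ++ v , (begin
    g ++ u ++ v     ≡⟨ ++-assoc g u v ⟨
    (g ++ u) ++ v   ≈⟨ ++-congʳ v gu≈uh ⟩
    (u ++ h) ++ v   ≡⟨ ++-assoc u h v ⟩
    u ++ h ++ v     ≈⟨ ++-congˡ u hv≈vk ⟩
    u ++ v ++ k     ≡⟨ ++-assoc u v k ⟨
    (u ++ v) ++ k   ∎)
    where open SetoidReasoning ≈-setoid

  -- Peel c v w: v arises from c ∷ w by moving c to the right past letters
  -- independent of it, i.e. a syntactic witness that c is minimal in v.
  data Peel (c : A) : List A → List A → Set (a ⊔ r) where
    here  : ∀ {w} → Peel c (c ∷ w) w
    there : ∀ {b v w} → θ c b → Peel c v w → Peel c (b ∷ v) (b ∷ w)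

  peel-past : ∀ {c x y} → All (θ c) x → Peel c (x ++ c ∷ y) (x ++ y)
  peel-past []          = here
  peel-past (t ∷ all-x) = there t (peel-past all-x)

  peel-++ : ∀ f {c s w} → Peel c (f ++ s) w →
            (Σ (List A) λ f₁ → Peel c f f₁) ⊎ (All (θ c) f × Σ (List A) λ s₁ → Peel c s s₁)
  peel-++ []      pl           = inj₂ ([] , _ , pl)
  peel-++ (b ∷ f) here         = inj₁ (f , here)
  peel-++ (b ∷ f) (there t pl) with peel-++ f pl
  ... | inj₁ (f₁ , pl₁)    = inj₁ (b ∷ f₁ , there t pl₁)
  ... | inj₂ (all-f , pl₂) = inj₂ (t ∷ all-f , pl₂)

  peel-swap : ∀ u {c x y v w} → θ x y → Peel c (u ++ x ∷ y ∷ v) w →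
              Σ (List A) λ w' → Peel c (u ++ y ∷ x ∷ v) w' × w ≈ w'
  peel-swap []      t here                    = _ , there t here , refl
  peel-swap []      t (there _ here)          = _ , here , refl
  peel-swap []      t (there s (there s' pl)) = _ , there s' (there s pl) , swap [] _ t
  peel-swap (d ∷ u) t here                    = _ , here , swap u _ t
  peel-swap (d ∷ u) t (there s pl) with peel-swap u t pl
  ... | w' , pl' , e = d ∷ w' , there s pl' , ++-congˡ [ d ] e

  module _ (ind : Independence A θ) where
    open Independence ind renaming (sym to θ-sym; irrefl to θ-irrefl)

    peel-sound : ∀ {c v w} → Peel c v w → v ≈ c ∷ w
    peel-sound here             = refl
    peel-sound (there {b} t pl) = trans (++-congˡ [ b ] (peel-sound pl)) (swap [] _ (θ-sym t))

    peel-independent : ∀ {c v w} → All (θ c) v → ¬ Peel c v w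
    peel-independent (t ∷ _)     here         = θ-irrefl t
    peel-independent (_ ∷ all-v) (there _ pl) = peel-independent all-v pl

    peel-transport  : ∀ {c v v' w} → v ≈ v' → Peel c v w →
                      Σ (List A) λ w' → Peel c v' w' × w ≈ w'
    peel-transport⁻ : ∀ {c v v' w} → v ≈ v' → Peel c v' w →
                      Σ (List A) λ w' → Peel c v w' × w ≈ w'

    peel-transport (swap u _ t) pl = peel-swap u t pl
    peel-transport refl         pl = _ , pl , refl
    peel-transport (sym e)      pl = peel-transport⁻ e pl
    peel-transport (trans e e') pl with peel-transport e pl
    ... | _ , pl₁ , e₁ with peel-transport e' pl₁
    ... | w₂ , pl₂ , e₂ = w₂ , pl₂ , trans e₁ e₂

    peel-transport⁻ (swap u _ t) pl = peel-swap u (θ-sym t) pl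
    peel-transport⁻ refl         pl = _ , pl , refl
    peel-transport⁻ (sym e)      pl = peel-transport e pl
    peel-transport⁻ (trans e e') pl with peel-transport⁻ e' pl
    ... | _ , pl₁ , e₁ with peel-transport⁻ e pl₁
    ... | w₂ , pl₂ , e₂ = w₂ , pl₂ , trans e₁ e₂

    peel-complete : ∀ {c v w} → c ∷ w ≈ v → Σ (List A) λ w' → Peel c v w' × w ≈ w'
    peel-complete e = peel-transport e here

    ∷-cancelˡ : ∀ {c w w'} → c ∷ w ≈ c ∷ w' → w ≈ w'
    ∷-cancelˡ e with peel-complete e
    ... | _ , here        , w≈w' = w≈w'
    ... | _ , there t _ , _    = ⊥-elim (θ-irrefl t)

    ∷≉[] : ∀ {c w} → ¬ (c ∷ w ≈ [])
    ∷≉[] e with peel-complete e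
    ... | _ , () , _

    peel-conjugator : ∀ {c f u f'} → f ++ c ∷ u ≈ c ∷ u ++ f' →
                      (Σ (List A) λ f₁ → f ≈ c ∷ f₁ × (f₁ ++ [ c ]) ++ u ≈ u ++ f')
                      ⊎ (f ++ u ≈ u ++ f')
    peel-conjugator {c} {f} {u} {f'} e with peel-complete (sym e)
    ... | _ , pl , _ with peel-++ f pl
    ... | inj₂ (all-f , _) = inj₂ (∷-cancelˡ (trans (sym (peel-sound (peel-past all-f))) e))
    ... | inj₁ (f₁ , pl₁)  = inj₁ (f₁ , f≈cf₁ , ∷-cancelˡ (begin
      c ∷ (f₁ ++ [ c ]) ++ u   ≡⟨ ++-assoc (c ∷ f₁) [ c ] u ⟩
      (c ∷ f₁) ++ c ∷ u        ≈⟨ ++-congʳ (c ∷ u) f≈cf₁ ⟨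
      f ++ c ∷ u               ≈⟨ e ⟩
      c ∷ u ++ f'              ∎))
      where
        open SetoidReasoning ≈-setoid
        f≈cf₁ : f ≈ c ∷ f₁
        f≈cf₁ = peel-sound pl₁

    conjugation-invariant : ∀ {ℓ} (P : List A → Set ℓ) → P Respects _≈_ →
                            (∀ {c w} → P (c ∷ w) → P (w ++ [ c ])) →
                            ∀ {f f'} → Conjugate θ f f' → P f → P f'
    conjugation-invariant P resp rotate (u , e) = go u e
      where
        go : ∀ u {f f'} → f ++ u ≈ u ++ f' → P f → P f'
        go []      {f} e Pf = resp (trans (≡⇒≈ (≡.sym (++-identityʳ f))) e) Pf
        go (c ∷ u) e Pf with peel-conjugator e
        ... | inj₁ (_ , f≈cf₁ , e') = go u e' (rotate (resp f≈cf₁ Pf))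
        ... | inj₂ e'               = go u e' Pf

    rotate-power : ∀ {c f g} p → c ∷ f ≈ g ^ p →
                   Σ (List A) λ h → f ++ [ c ] ≈ h ^ p × Conjugate θ g h
    rotate-power zero e = ⊥-elim (∷≉[] e)
    rotate-power {c} {f} {g} (suc q) e with peel-complete e
    ... | _ , pl , _ with peel-++ g pl
    ... | inj₂ (all-g , _ , pl') = ⊥-elim (peel-independent (all-^ all-g q) pl')
    ... | inj₁ (g₁ , pl₁) = g₁ ++ [ c ] , fc≈hᵖ , ([ c ] , ++-congʳ [ c ] g≈cg₁)
      where
        open SetoidReasoning ≈-setoid
        g≈cg₁ : g ≈ c ∷ g₁
        g≈cg₁ = peel-sound pl₁
        fc≈hᵖ : f ++ [ c ] ≈ (g₁ ++ [ c ]) ^ suc q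
        fc≈hᵖ = begin
          f ++ [ c ]                          ≈⟨ ++-congʳ [ c ] (∷-cancelˡ (trans e (^-cong g≈cg₁ (suc q)))) ⟩
          (g₁ ++ ([ c ] ++ g₁) ^ q) ++ [ c ]  ≡⟨ ^-rotate g₁ [ c ] q ⟩
          (g₁ ++ [ c ]) ^ suc q               ∎

ConjugatePower : ∀ {a r} {A : Set a} (θ : A → A → Set r) → List A → ℕ → List A → Set (a ⊔ r)
ConjugatePower {A = A} θ g p f = Σ (List A) λ h → f ≈[ θ ] (h ^ p) × Conjugate θ g h

proposition1 : ∀ {a r : Level} {A : Set a} (θ : A → A → Set r) → Independence A θ →
    (f g : List A) (p : ℕ) → f ≈[ θ ] (g ^ p) →
    (f' : List A) → Conjugate θ f f' →
    Σ (List A) (λ g' → (f' ≈[ θ ] (g' ^ p)) × Conjugate θ g g')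
proposition1 θ ind f g p f≈gᵖ f' f~f' =
  conjugation-invariant ind (ConjugatePower θ g p) respects rotate f~f' (g , f≈gᵖ , conjugate-refl g)
  where
    respects : ConjugatePower θ g p Respects TraceEq θ
    respects f≈f' (h , f≈hᵖ , g~h) = h , trans (sym f≈f') f≈hᵖ , g~h
    rotate : ∀ {c w} → ConjugatePower θ g p (c ∷ w) → ConjugatePower θ g p (w ++ [ c ])
    rotate (h , cw≈hᵖ , g~h) with rotate-power ind p cw≈hᵖ
    ... | h' , wc≈h'ᵖ , h~h' = h' , wc≈h'ᵖ , conjugate-trans g~h h~h'
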